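{- Let $T$ be a plane rooted tree and write $Q(T)=c_0+c_1q+\dots+c_Nq^N$ with $N=\deg Q(T)$. Then $c_0=c_N=1$ and $c_i>0$ for every $0\le i\le N$.
   Context: A plane rooted tree is a finite tree with a distinguished vertex (the root), embedded in the plane so that it grows upward from the root. A leaf is a vertex of degree $1$ different from the root. For a leaf $v$ of $T$, $r(T,v)$ denotes the number of edges of $T$ lying to the right of the unique path connecting $v$ with the root, and $T-v$ is the plane rooted tree obtained by deleting $v$ and its incident edge. The plucking polynomial $Q(T)\in\mathbb{Z}[q]$ is defined recursively: if $T$ has a single vertex then $Q(T)=1$; otherwise $Q(T)=\sum_{v \text{ leaf of } T} q^{r(T,v)}Q(T-v)$. -}

module Defs where

open import Data.Nat using (ℕ; zero; suc; _+_; _<_)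
open import Data.Integer using (ℤ; 0ℤ; 1ℤ) renaming (_+_ to _+ℤ_)
open import Data.List using (List; []; _∷_; _++_; map; replicate)
open import Data.Product using (_×_; _,_)
open import Relation.Binary.PropositionalEquality using (_≡_; _≢_)

-- Plane rooted trees: a vertex together with the ordered (left-to-right)
-- list of its children subtrees. The outermost node is the root.
data Tree : Set where
  node : List Tree → Tree

mutual
  edges : Tree → ℕ
  edges (node ts) = edgesF ts

  edgesF : List Tree → ℕ
  edgesF []       = 0
  edgesF (t ∷ ts) = suc (edges t) + edgesF ts

-- For a forest ts of children of some vertex, list every leaf v lying in it,
-- as a pair (r, ts') where r = number of edges inside the forest lying to the
-- right of the path from v up to the common parent, and ts' = the forest with
-- v (and its incident edge) deleted.
forestLeaves : List Tree → List (ℕ × List Tree)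
forestLeaves [] = []
forestLeaves (node [] ∷ ts) =
  (edgesF ts , ts) ∷ map (λ { (r , ts') → (r , node [] ∷ ts') }) (forestLeaves ts)
forestLeaves (node (c ∷ cs) ∷ ts) =
  map (λ { (r , cs') → (r + edgesF ts , node cs' ∷ ts) }) (forestLeaves (c ∷ cs))
  ++ map (λ { (r , ts') → (r , node (c ∷ cs) ∷ ts') }) (forestLeaves ts)

-- All leaves v of T (the root is never a leaf), as pairs (r(T,v), T - v).
leaves : Tree → List (ℕ × Tree)
leaves (node ts) = map (λ { (r , ts') → (r , node ts') }) (forestLeaves ts)

-- Polynomials in ℤ[q] as coefficient lists, lowest degree first.
Poly : Set
Poly = List ℤ

_⊕_ : Poly → Poly → Poly
[]       ⊕ q        = q
(a ∷ p)  ⊕ []       = a ∷ p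
(a ∷ p)  ⊕ (b ∷ q)  = (a +ℤ b) ∷ (p ⊕ q)

shift : ℕ → Poly → Poly
shift r p = replicate r 0ℤ ++ p

coeff : Poly → ℕ → ℤ
coeff []      _       = 0ℤ
coeff (a ∷ p) zero    = a
coeff (a ∷ p) (suc i) = coeff p i

IsDegree : Poly → ℕ → Set
IsDegree p N = coeff p N ≢ 0ℤ × (∀ i → N < i → coeff p i ≡ 0ℤ)

-- Plucking polynomial, computed with fuel = number of edges
-- (deleting a leaf removes exactly one edge; a tree with 0 edges is a single vertex).
sumPoly : List Poly → Poly
sumPoly []       = []
sumPoly (p ∷ ps) = p ⊕ sumPoly ps

QF : ℕ → Tree → Poly
QF zero    _ = 1ℤ ∷ []
QF (suc n) t = sumPoly (map (λ { (r , t') → shift r (QF n t') }) (leaves t))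

Q : Tree → Poly
Q t = QF (edges t) t

module Submission where

-- We show that Q(T) is "spread" on [0, d(T)]: its coefficients are
-- nonnegative, vanish outside [0, d(T)], are positive on it, and the
-- extreme coefficients equal 1.  Here d(T) (degT below) counts the pairs of
-- edges lying side by side, neither an ancestor of the other.
--
-- The recursion Q(T) = Σ_v q^r(T,v) Q(T - v) turns this into a statement
-- about intervals: the summand of the leaf v is spread on
-- [r(T,v), r(T,v) + d(T - v)], and a sum of spread polynomials is spread on
-- [0, D] as soon as, listed left to right, the intervals form a
-- "staircase": consecutive intervals leave no gap, only the last one starts
-- at 0, and only the first one reaches D.  Staircases are closed under
-- shifting and concatenation, and the leaf list of a forest is built from
-- the leaf lists of smaller forests by exactly these operations, so an
-- induction on the forest shows that its leaves form a staircase topped by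
-- its degree.

open import Defs
open import Data.Nat using (ℕ; zero; suc; _+_; _*_; _≤_; _≤?_; z≤n; s≤s)
  renaming (_<_ to _<ₙ_)
import Data.Nat.Properties as ℕₚ
open import Data.Nat.Tactic.RingSolver using (solve-∀)
open import Data.Integer using (0ℤ; 1ℤ; _<_; +<+; +≤+) renaming (_+_ to _+ℤ_; _≤_ to _≤ℤ_)
import Data.Integer.Properties as ℤₚ
open import Data.List using (List; []; _∷_; _++_; map)
open import Data.List.Properties using (map-∘; ++-identityʳ)
open import Data.List.Relation.Unary.All using (All; []; _∷_)
import Data.List.Relation.Unary.All as All
open import Data.List.Relation.Unary.All.Properties using (map⁺; ++⁺)
open import Data.Product using (_×_; _,_; proj₁; proj₂; ∃-syntax)
open import Relation.Binary.PropositionalEquality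
open import Relation.Nullary using (yes; no)

coeff-⊕ : ∀ p p' i → coeff (p ⊕ p') i ≡ coeff p i +ℤ coeff p' i
coeff-⊕ []      p'       i       = sym (ℤₚ.+-identityˡ _)
coeff-⊕ (a ∷ p) []       i       = sym (ℤₚ.+-identityʳ _)
coeff-⊕ (a ∷ p) (b ∷ p') zero    = refl
coeff-⊕ (a ∷ p) (b ∷ p') (suc i) = coeff-⊕ p p' i

record Spread (p : Poly) (a b : ℕ) : Set where
  field
    nonneg       : ∀ i → 0ℤ ≤ℤ coeff p i
    positive     : ∀ i → a ≤ i → i ≤ b → 0ℤ < coeff p i
    vanish-below : ∀ i → i <ₙ a → coeff p i ≡ 0ℤ
    vanish-above : ∀ i → b <ₙ i → coeff p i ≡ 0ℤ
    lowest       : coeff p a ≡ 1ℤ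
    highest      : coeff p b ≡ 1ℤ

spread-one : Spread (1ℤ ∷ []) 0 0
spread-one = record
  { nonneg       = λ { zero → +≤+ z≤n ; (suc i) → ℤₚ.≤-refl }
  ; positive     = λ { zero _ _ → +<+ (s≤s z≤n) }
  ; vanish-below = λ _ ()
  ; vanish-above = λ { (suc i) _ → refl }
  ; lowest       = refl
  ; highest      = refl
  }

spread-times-q : ∀ {p a b} → Spread p a b → Spread (0ℤ ∷ p) (suc a) (suc b)
spread-times-q s = record
  { nonneg       = λ { zero → ℤₚ.≤-refl ; (suc i) → nonneg i }
  ; positive     = λ { (suc i) (s≤s a≤i) (s≤s i≤b) → positive i a≤i i≤b }
  ; vanish-below = λ { zero _ → refl ; (suc i) (s≤s i<a) → vanish-below i i<a }
  ; vanish-above = λ { (suc i) (s≤s b<i) → vanish-above i b<i }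
  ; lowest       = lowest
  ; highest      = highest
  }
  where open Spread s

spread-shift : ∀ r {p a b} → Spread p a b → Spread (shift r p) (r + a) (r + b)
spread-shift zero    s = s
spread-shift (suc r) s = spread-times-q (spread-shift r s)

module Staircases {A : Set} (lo hi : A → ℕ) where

  -- Each interval starts at most one step above the end of the next one,
  -- so together they cover an interval without gaps.
  data Linked : List A → Set where
    [_]  : ∀ x → Linked (x ∷ [])
    link : ∀ {x y ys} → lo x ≤ suc (hi y) → Linked (y ∷ ys) → Linked (x ∷ y ∷ ys)

  data Grounded (c : ℕ) : List A → Set where
    ends   : ∀ {x} → lo x ≡ c → Grounded c (x ∷ [])
    passes : ∀ {x xs} → 1 ≤ lo x → Grounded c xs → Grounded c (x ∷ xs)

  data Capped (D : ℕ) : List A → Set where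
    capped : ∀ {x xs} → hi x ≡ D → All (λ y → hi y <ₙ D) xs → Capped D (x ∷ xs)

  record Staircase (c D : ℕ) (xs : List A) : Set where
    constructor staircase
    field
      linked   : Linked xs
      grounded : Grounded c xs
      topped   : Capped D xs

  capped-≤ : ∀ {D xs} → Capped D xs → All (λ x → hi x ≤ D) xs
  capped-≤ (capped top below) = ℕₚ.≤-reflexive top ∷ All.map ℕₚ.<⇒≤ below

  staircase-single : ∀ x → Staircase (lo x) (hi x) (x ∷ [])
  staircase-single x = staircase [ x ] (ends refl) (capped refl [])

  staircase-cast : ∀ {c c' D D' xs ys} → c ≡ c' → D ≡ D' → xs ≡ ys →
                   Staircase c D xs → Staircase c' D' ys
  staircase-cast refl refl refl s = s

  staircase-++ : ∀ {c c' D D' xs ys} → Staircase c D xs → Staircase c' D' ys →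
                 1 ≤ c → c ≤ suc D' → D' <ₙ D → Staircase c' D (xs ++ ys)
  staircase-++ {c} {c'} {D} (staircase lx gx tx) (staircase ly gy ty@(capped top-y _))
               1≤c c≤D' D'<D =
    staircase (linked-++ lx gx) (grounded-++ gx) (capped-++ tx)
    where
    linked-++ : ∀ {xs} → Linked xs → Grounded _ xs → Linked (xs ++ _)
    linked-++ [ x ] (ends refl) = link (subst (λ v → c ≤ suc v) (sym top-y) c≤D') ly
    linked-++ (link h l) (passes _ g) = link h (linked-++ l g)

    grounded-++ : ∀ {xs} → Grounded _ xs → Grounded c' (xs ++ _)
    grounded-++ (ends refl)  = passes 1≤c gy
    grounded-++ (passes h g) = passes h (grounded-++ g)

    capped-++ : ∀ {xs} → Capped _ xs → Capped D (xs ++ _)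
    capped-++ (capped top below) =
      capped top (++⁺ below (All.map (λ h → ℕₚ.≤-<-trans h D'<D) (capped-≤ ty)))

module Reindexing {A B : Set} (lo hi : A → ℕ) (lo' hi' : B → ℕ) where
  open Staircases

  Shifts : (A → B) → ℕ → ℕ → A → Set
  Shifts f a b x = (lo' (f x) ≡ lo x + a) × (hi' (f x) ≡ hi x + b)

  staircase-map : ∀ f a b {c D xs} → a ≤ b → All (Shifts f a b) xs →
                  Staircase lo hi c D xs → Staircase lo' hi' (c + a) (D + b) (map f xs)
  staircase-map f a b {D = D} a≤b shifts@((_ , hi-x) ∷ shifts-rest)
                (staircase l g (capped top below)) =
    staircase (linked-map shifts l) (grounded-map shifts g)
      (capped (trans hi-x (cong (_+ b) top)) (below-map shifts-rest below))
    where
    linked-map : ∀ {xs} → All (Shifts f a b) xs → Linked lo hi xs → Linked lo' hi' (map f xs)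
    linked-map _ [ x ] = [ f x ]
    linked-map ((lo-x , _) ∷ sy@(_ , hi-y) ∷ ss) (link h l) =
      link (subst₂ (λ u v → u ≤ suc v) (sym lo-x) (sym hi-y) (ℕₚ.+-mono-≤ h a≤b))
           (linked-map (sy ∷ ss) l)

    grounded-map : ∀ {c xs} → All (Shifts f a b) xs → Grounded lo hi c xs →
                   Grounded lo' hi' (c + a) (map f xs)
    grounded-map ((lo-x , _) ∷ []) (ends e) = ends (trans lo-x (cong (_+ a) e))
    grounded-map ((lo-x , _) ∷ ss) (passes h g) =
      passes (subst (1 ≤_) (sym lo-x) (ℕₚ.≤-trans h (ℕₚ.m≤m+n _ a))) (grounded-map ss g)

    below-map : ∀ {xs} → All (Shifts f a b) xs → All (λ y → hi y <ₙ D) xs →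
                All (λ y → hi' y <ₙ D + b) (map f xs)
    below-map [] [] = []
    below-map ((_ , hi-y) ∷ ss) (h ∷ hs) =
      subst (_<ₙ D + b) (sym hi-y) (ℕₚ.+-monoˡ-< b h) ∷ below-map ss hs

module Sums {A : Set} (lo hi : A → ℕ) (F : A → Poly) where
  open Staircases lo hi

  Σ[_] : List A → Poly
  Σ[ xs ] = sumPoly (map F xs)

  Spreads : List A → Set
  Spreads = All (λ x → Spread (F x) (lo x) (hi x))

  sum-nonneg : ∀ {xs} → Spreads xs → ∀ i → 0ℤ ≤ℤ coeff Σ[ xs ] i
  sum-nonneg [] i = ℤₚ.≤-refl
  sum-nonneg {x ∷ xs} (s ∷ ss) i rewrite coeff-⊕ (F x) Σ[ xs ] i =
    ℤₚ.+-mono-≤ (Spread.nonneg s i) (sum-nonneg ss i)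

  sum-vanish : ∀ {xs} i → Spreads xs → All (λ x → hi x <ₙ i) xs → coeff Σ[ xs ] i ≡ 0ℤ
  sum-vanish i [] [] = refl
  sum-vanish {x ∷ xs} i (s ∷ ss) (h ∷ hs)
    rewrite coeff-⊕ (F x) Σ[ xs ] i | Spread.vanish-above s i h | sum-vanish i ss hs = refl

  coeff-single : ∀ x i → coeff Σ[ x ∷ [] ] i ≡ coeff (F x) i
  coeff-single x i = trans (coeff-⊕ (F x) [] i) (ℤₚ.+-identityʳ _)

  -- Below the end of the first interval, the union of the intervals has no
  -- gap, so some term is positive there.
  sum-positive : ∀ {x xs} → Spreads (x ∷ xs) → Linked (x ∷ xs) → Grounded 0 (x ∷ xs) →
                 ∀ i → i ≤ hi x → 0ℤ < coeff Σ[ x ∷ xs ] i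
  sum-positive {x} (s ∷ []) _ (ends lo≡0) i i≤hi =
    subst (0ℤ <_) (sym (coeff-single x i))
      (Spread.positive s i (subst (_≤ i) (sym lo≡0) z≤n) i≤hi)
  sum-positive {x} {y ∷ ys} (s ∷ ss) (link lo≤hi l) (passes _ g) i i≤hi
    rewrite coeff-⊕ (F x) Σ[ y ∷ ys ] i with i ≤? hi y
  ... | yes i≤hi-y = ℤₚ.+-mono-≤-< (Spread.nonneg s i) (sum-positive ss l g i i≤hi-y)
  ... | no  i≰hi-y = ℤₚ.+-mono-<-≤
    (Spread.positive s i (ℕₚ.≤-trans lo≤hi (ℕₚ.≰⇒> i≰hi-y)) i≤hi) (sum-nonneg ss i)

  -- Only the last interval contains 0.
  sum-lowest : ∀ {xs} → Spreads xs → Grounded 0 xs → coeff Σ[ xs ] 0 ≡ 1ℤ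
  sum-lowest {x ∷ []} (s ∷ []) (ends lo≡0) =
    trans (coeff-single x 0) (subst (λ k → coeff (F x) k ≡ 1ℤ) lo≡0 (Spread.lowest s))
  sum-lowest {x ∷ xs} (s ∷ ss) (passes 1≤lo g)
    rewrite coeff-⊕ (F x) Σ[ xs ] 0 | Spread.vanish-below s 0 1≤lo | sum-lowest ss g = refl

  -- Only the first interval contains D.
  sum-highest : ∀ {D xs} → Spreads xs → Capped D xs → coeff Σ[ xs ] D ≡ 1ℤ
  sum-highest {D} {x ∷ xs} (s ∷ ss) (capped refl below)
    rewrite coeff-⊕ (F x) Σ[ xs ] D | Spread.highest s | sum-vanish D ss below = refl

  sum-spread : ∀ {D xs} → Spreads xs → Staircase 0 D xs → Spread Σ[ xs ] 0 D
  sum-spread {D} {x ∷ xs} ss (staircase l g t@(capped top _)) = record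
    { nonneg       = sum-nonneg ss
    ; positive     = λ i _ i≤D → sum-positive ss l g i (subst (i ≤_) (sym top) i≤D)
    ; vanish-below = λ _ ()
    ; vanish-above = λ i D<i → sum-vanish i ss (All.map (λ h → ℕₚ.≤-<-trans h D<i) (capped-≤ t))
    ; lowest       = sum-lowest ss g
    ; highest      = sum-highest ss t
    }

-- deg of a tree / forest: the number of pairs of edges (e, e') with e to the
-- left of e' and neither an ancestor of the other.
mutual
  degT : Tree → ℕ
  degT (node ts) = degF ts

  degF : List Tree → ℕ
  degF []       = 0
  degF (t ∷ ts) = degF ts + edgesF ts * suc (edges t) + degT t

Leaf : Set
Leaf = ℕ × List Tree

leafLo : Leaf → ℕ
leafLo = proj₁

leafHi : Leaf → ℕ
leafHi (r , ts') = r + degF ts'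

open Staircases leafLo leafHi
open Reindexing leafLo leafHi leafLo leafHi

OneEdgeFewer : List Tree → Leaf → Set
OneEdgeFewer ts x = suc (edgesF (proj₂ x)) ≡ edgesF ts

leaves-one-edge-fewer : ∀ ts → All (OneEdgeFewer ts) (forestLeaves ts)
leaves-one-edge-fewer [] = []
leaves-one-edge-fewer (node [] ∷ ts) =
  refl ∷ map⁺ (All.map (cong suc) (leaves-one-edge-fewer ts))
leaves-one-edge-fewer (node (c ∷ cs) ∷ ts) =
  ++⁺ (map⁺ (All.map (cong (λ k → suc (k + edgesF ts))) (leaves-one-edge-fewer (c ∷ cs))))
      (map⁺ (All.map (λ {x} e → trans (sym (ℕₚ.+-suc E₁ (edgesF (proj₂ x)))) (cong (E₁ +_) e))
                     (leaves-one-edge-fewer ts)))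
  where
  E₁ = suc (edgesF (c ∷ cs))

-- The leftmost tree is a single vertex: its leaf comes first, with interval
-- [E, E + deg ts], followed by the leaves of ts raised by E - 1 at the top.
staircase-leaf-first : ∀ t ts → Staircase 0 (degF (t ∷ ts)) (forestLeaves (t ∷ ts)) →
                       Staircase 0 (degF (node [] ∷ t ∷ ts)) (forestLeaves (node [] ∷ t ∷ ts))
staircase-leaf-first t ts st =
  staircase-cast refl (degree-eq E' D) refl
    (staircase-++ (staircase-single (E , t ∷ ts)) (staircase-map _ 0 E' z≤n shifts st)
       (s≤s z≤n) (s≤s (ℕₚ.m≤n+m E' D)) (s≤s (ℕₚ.≤-reflexive (ℕₚ.+-comm D E'))))
  where
  E' = edges t + edgesF ts
  E  = suc E'
  D  = degF (t ∷ ts)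

  degree-eq : ∀ e d → suc e + d ≡ d + suc e * 1 + 0
  degree-eq = solve-∀

  raise-eq : ∀ r d e → r + (d + e * 1 + 0) ≡ r + d + e
  raise-eq = solve-∀

  shifts : All (Shifts (λ { (r , ts') → r , node [] ∷ ts' }) 0 E') (forestLeaves (t ∷ ts))
  shifts = All.map (λ { {r , ts'} e → sym (ℕₚ.+-identityʳ r)
                      , trans (raise-eq r (degF ts') (edgesF ts'))
                              (cong (r + degF ts' +_) (ℕₚ.suc-injective e)) })
                   (leaves-one-edge-fewer (t ∷ ts))

-- The forest is a single tree with children c ∷ cs: its leaves are those of
-- c ∷ cs, with unchanged intervals.
staircase-only-child : ∀ c cs → Staircase 0 (degF (c ∷ cs)) (forestLeaves (c ∷ cs)) →
                       Staircase 0 (degF (node (c ∷ cs) ∷ [])) (forestLeaves (node (c ∷ cs) ∷ []))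
staircase-only-child c cs st =
  staircase-cast refl (ℕₚ.+-identityʳ (degF (c ∷ cs))) (sym (++-identityʳ _))
    (staircase-map _ 0 0 z≤n (All.tabulate (λ {x} _ → shifts x)) st)
  where
  raise-eq : ∀ r d → r + 0 + d ≡ r + d + 0
  raise-eq = solve-∀

  shifts : ∀ x → Shifts (λ { (r , cs') → r + 0 , node cs' ∷ [] }) 0 0 x
  shifts (r , cs') = refl , raise-eq r (degF cs')

-- The leftmost tree has children c ∷ cs and is followed by t ∷ ts, which has
-- E = E' + 1 edges.  First come the leaves of c ∷ cs, whose intervals are
-- raised by E at the bottom; then the leaves of t ∷ ts, whose intervals are
-- raised only at the top.
staircase-subtree-first : ∀ c cs t ts →
  Staircase 0 (degF (c ∷ cs)) (forestLeaves (c ∷ cs)) →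
  Staircase 0 (degF (t ∷ ts)) (forestLeaves (t ∷ ts)) →
  Staircase 0 (degF (node (c ∷ cs) ∷ t ∷ ts)) (forestLeaves (node (c ∷ cs) ∷ t ∷ ts))
staircase-subtree-first c cs t ts left right =
  staircase-cast refl (top-eq D₁ D₂ E₁ E') refl
    (staircase-++ (staircase-map _ E left-raise (ℕₚ.≤-trans (ℕₚ.m≤m+n E D₂) (ℕₚ.m≤m+n _ _))
                                 left-shifts left)
                  (staircase-map _ 0 right-raise z≤n right-shifts right)
                  (s≤s z≤n) (s≤s no-gap) right-below-left)
  where
  D₁ = degF (c ∷ cs)
  E₁ = edgesF (c ∷ cs)
  D₂ = degF (t ∷ ts)
  E' = edges t + edgesF ts
  E  = suc E'
  left-raise  = E + D₂ + E * E₁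
  right-raise = E' * suc E₁ + D₁

  top-eq : ∀ d₁ d₂ e₁ e' → d₁ + (suc e' + d₂ + suc e' * e₁) ≡ d₂ + suc e' * suc e₁ + d₁
  top-eq = solve-∀

  right-top-eq : ∀ d₁ d₂ e₁ e' → d₁ + (suc e' + d₂ + suc e' * e₁) ≡ suc (d₂ + (e' * suc e₁ + d₁) + e₁)
  right-top-eq = solve-∀

  left-raise-eq : ∀ r e d₂ s d → r + e + (d₂ + e * s + d) ≡ r + d + (e + d₂ + e * s)
  left-raise-eq = solve-∀

  right-raise-eq : ∀ r d e s d₁ → r + (d + e * s + d₁) ≡ r + d + (e * s + d₁)
  right-raise-eq = solve-∀

  no-gap : E' ≤ D₂ + right-raise
  no-gap = ℕₚ.≤-trans (ℕₚ.m≤m*n E' (suc E₁)) (ℕₚ.≤-trans (ℕₚ.m≤m+n _ D₁) (ℕₚ.m≤n+m _ D₂))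

  right-below-left : D₂ + right-raise <ₙ D₁ + left-raise
  right-below-left = subst (D₂ + right-raise <ₙ_) (sym (right-top-eq D₁ D₂ E₁ E'))
                           (s≤s (ℕₚ.m≤m+n _ E₁))

  left-shifts : All (Shifts (λ { (r , cs') → r + E , node cs' ∷ t ∷ ts }) E left-raise)
                    (forestLeaves (c ∷ cs))
  left-shifts = All.map
    (λ { {r , cs'} e → refl
       , trans (left-raise-eq r E D₂ (suc (edgesF cs')) (degF cs'))
               (cong (λ s → r + degF cs' + (E + D₂ + E * s)) e) })
    (leaves-one-edge-fewer (c ∷ cs))

  right-shifts : All (Shifts (λ { (r , ts') → r , node (c ∷ cs) ∷ ts' }) 0 right-raise)
                     (forestLeaves (t ∷ ts))
  right-shifts = All.map
    (λ { {r , ts'} e → sym (ℕₚ.+-identityʳ r)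
       , trans (right-raise-eq r (degF ts') (edgesF ts') (suc E₁) D₁)
               (cong (λ e' → r + degF ts' + (e' * suc E₁ + D₁)) (ℕₚ.suc-injective e)) })
    (leaves-one-edge-fewer (t ∷ ts))

forest-staircase : ∀ t ts → Staircase 0 (degF (t ∷ ts)) (forestLeaves (t ∷ ts))
forest-staircase (node [])       []       = staircase-single (0 , [])
forest-staircase (node [])       (t ∷ ts) = staircase-leaf-first t ts (forest-staircase t ts)
forest-staircase (node (c ∷ cs)) []       = staircase-only-child c cs (forest-staircase c cs)
forest-staircase (node (c ∷ cs)) (t ∷ ts) =
  staircase-subtree-first c cs t ts (forest-staircase c cs) (forest-staircase t ts)

plucking-spread : ∀ n T → edges T ≡ n → Spread (QF n T) 0 (degT T)
plucking-spread zero    (node [])       _  = spread-one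
plucking-spread zero    (node (_ ∷ _))  ()
plucking-spread (suc n) (node [])       ()
plucking-spread (suc n) (node (t ∷ ts)) e =
  subst (λ p → Spread p 0 (degF (t ∷ ts))) (cong sumPoly (map-∘ (forestLeaves (t ∷ ts))))
    (Sums.sum-spread leafLo leafHi term
      (All.map term-spread (leaves-one-edge-fewer (t ∷ ts))) (forest-staircase t ts))
  where
  term : Leaf → Poly
  term (r , ts') = shift r (QF n (node ts'))

  term-spread : ∀ {x} → OneEdgeFewer (t ∷ ts) x → Spread (term x) (leafLo x) (leafHi x)
  term-spread {r , ts'} e' =
    subst (λ a → Spread (term (r , ts')) a (leafHi (r , ts'))) (ℕₚ.+-identityʳ r)
      (spread-shift r (plucking-spread n (node ts') (ℕₚ.suc-injective (trans e' e))))

corollary2p4 : (T : Tree) → ∃[ N ] (IsDegree (Q T) N × coeff (Q T) 0 ≡ 1ℤ × coeff (Q T) N ≡ 1ℤ × (∀ i → i ≤ N → 0ℤ < coeff (Q T) i))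
corollary2p4 T =
  degT T , (highest-nonzero , vanish-above) , lowest , highest , λ i → positive i z≤n
  where
  open Spread (plucking-spread (edges T) T refl)

  highest-nonzero : coeff (Q T) (degT T) ≢ 0ℤ
  highest-nonzero eq with trans (sym highest) eq
  ... | ()
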